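{- Suppose a finite connected graph $G$ contains three central vertices, each of which is uniquely eccentric. Then $\mathsf{DL}(G) \leq r(G)-1$.
   Context: For a finite connected graph $G=(V,E)$ with $|V|=n$ and graph distance $d$, a $k$-dispersed labelling is a bijection $\phi:\{1,\dots,n\}\to V$ with $d(\phi(i),\phi(i+1))\ge k$ for $1\le i\le n-1$; $\mathsf{DL}(G)$ is the maximum such $k$. The eccentricity of $v$ is $\epsilon(v)=\max_{u\in V} d(v,u)$; the radius is $r(G)=\min_v \epsilon(v)$. A vertex $v$ is central if $\epsilon(v)=r(G)$, and uniquely eccentric if there is exactly one vertex $u$ with $d(u,v)=\epsilon(v)$. -}

module Defs where

open import Data.Nat using (ℕ; zero; suc; _≤_; _⊔_)
open import Data.Fin using (Fin; toℕ)
open import Data.List using (foldr; map; allFin)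
open import Data.Product using (_×_; ∃)
open import Relation.Binary.PropositionalEquality using (_≡_)
open import Relation.Nullary using (¬_)
open import Function.Bundles using (Bijection)
open import Relation.Binary.PropositionalEquality using (setoid)
open import Function.Bundles using (_⤖_)

record Graph (n : ℕ) : Set₁ where
  field
    Adj   : Fin n → Fin n → Set
    sym   : ∀ {u v} → Adj u v → Adj v u
    irrefl : ∀ {u} → ¬ Adj u u

open Graph public

data Walk {n : ℕ} (G : Graph n) : Fin n → Fin n → ℕ → Set where
  here : ∀ {u} → Walk G u u zero
  step : ∀ {u w v k} → Adj G u w → Walk G w v k → Walk G u v (suc k)

Connected : ∀ {n} → Graph n → Set
Connected {n} G = ∀ (u v : Fin n) → ∃ λ k → Walk G u v k

IsDistance : ∀ {n} → Graph n → (Fin n → Fin n → ℕ) → Set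
IsDistance {n} G d = ∀ (u v : Fin n) →
  Walk G u v (d u v) × (∀ m → Walk G u v m → d u v ≤ m)

ecc : ∀ {n} → (Fin n → Fin n → ℕ) → Fin n → ℕ
ecc {n} d v = foldr _⊔_ 0 (map (d v) (allFin n))

IsRadius : ∀ {n} → (Fin n → Fin n → ℕ) → ℕ → Set
IsRadius {n} d r = (∃ λ (v : Fin n) → ecc d v ≡ r) × (∀ (v : Fin n) → r ≤ ecc d v)

Central : ∀ {n} → (Fin n → Fin n → ℕ) → ℕ → Fin n → Set
Central d r v = ecc d v ≡ r

UniquelyEccentric : ∀ {n} → (Fin n → Fin n → ℕ) → Fin n → Set
UniquelyEccentric {n} d v =
  ∃ (λ (u : Fin n) → d v u ≡ ecc d v) ×
  (∀ (u w : Fin n) → d v u ≡ ecc d v → d v w ≡ ecc d v → u ≡ w)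

-- φ : {1..n} → V bijection (positions encoded as Fin n, 0-based), consecutive labels at distance ≥ k
Dispersed : ∀ {n} → (Fin n → Fin n → ℕ) → ℕ → (Fin n ⤖ Fin n) → Set
Dispersed {n} d k φ = ∀ (i j : Fin n) → toℕ j ≡ suc (toℕ i) →
  k ≤ d (Bijection.to φ i) (Bijection.to φ j)

-- DL(G) ≤ m  ⇔  every k-dispersed labelling has k ≤ m
DL≤ : ∀ {n} → (Fin n → Fin n → ℕ) → ℕ → Set
DL≤ {n} d m = ∀ (k : ℕ) (φ : Fin n ⤖ Fin n) → Dispersed d k φ → k ≤ m

-- If the labelling is k-dispersed with k ≥ r, a central, uniquely eccentric
-- vertex v cannot sit strictly inside the sequence φ(1), …, φ(n): both of its
-- neighbours in the sequence are at distance ≥ r = ε(v) from v, so both would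
-- be the unique vertex at distance ε(v), contradicting injectivity of φ. Hence
-- each such vertex is labelled 1 or n, and three of them cannot fit.
module Submission where

open import Defs
open import Data.Nat using (ℕ; zero; suc; _∸_; _≤_; _<_; _⊔_; _≟_; z≤n; s≤s)
open import Data.Nat.Properties
  using (≤-trans; ≤-antisym; m≤m⊔n; m≤n⊔m; ≤∧≢⇒<; ≰⇒>; n<1+n; <⇒≤; <⇒≢; m<n+m; <⇒≤pred; suc-injective)
open import Data.Fin using (Fin; toℕ; fromℕ<)
open import Data.Fin.Properties using (toℕ-fromℕ<; toℕ<n; toℕ-injective)
open import Data.List using (List; _∷_; foldr; map)
open import Data.List.Membership.Propositional using (_∈_)
open import Data.List.Membership.Propositional.Properties using (∈-allFin)
open import Data.List.Relation.Unary.Any using (here; there)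
open import Data.Product using (_×_; _,_; proj₁; proj₂; ∃₂)
open import Data.Sum using (_⊎_; inj₁; inj₂; [_,_]′)
import Data.Sum as Sum
open import Relation.Nullary using (¬_; contradiction)
open import Relation.Nullary.Decidable using (Dec; decidable-stable; _⊎-dec_)
open import Relation.Binary.PropositionalEquality
  using (_≡_; _≢_; refl; trans; cong; subst) renaming (sym to ≡-sym)
open import Function.Base using (_∘_)
open import Function.Bundles using (Bijection; _⤖_)

module _ {n : ℕ} {G : Graph n} where

  snoc : ∀ {u w v k} → Walk G u w k → Adj G w v → Walk G u v (suc k)
  snoc here       e′ = step e′ here
  snoc (step e w) e′ = step e (snoc w e′)

  reverse : ∀ {u v k} → Walk G u v k → Walk G v u k
  reverse here       = here
  reverse (step e w) = snoc (reverse w) (Graph.sym G e)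

  distance-sym : ∀ {d} → IsDistance G d → ∀ u v → d u v ≡ d v u
  distance-sym {d} D u v = ≤-antisym (shortest u v) (shortest v u)
    where
    shortest : ∀ x y → d x y ≤ d y x
    shortest x y = proj₂ (D x y) (d y x) (reverse (proj₁ (D y x)))

f≤foldr-⊔ : ∀ {A : Set} (f : A → ℕ) {x} {xs : List A} → x ∈ xs → f x ≤ foldr _⊔_ 0 (map f xs)
f≤foldr-⊔ f {xs = y ∷ _} (here refl) = m≤m⊔n (f y) _
f≤foldr-⊔ f {xs = y ∷ _} (there x∈) = ≤-trans (f≤foldr-⊔ f x∈) (m≤n⊔m (f y) _)

d≤ecc : ∀ {n} (d : Fin n → Fin n → ℕ) v u → d v u ≤ ecc d v
d≤ecc d v u = f≤foldr-⊔ (d v) (∈-allFin u)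

uniquelyEccentric-farthest-unique : ∀ {n} {d : Fin n → Fin n → ℕ} {v} → UniquelyEccentric d v →
  ∀ {u w} → ecc d v ≤ d v u → ecc d v ≤ d v w → u ≡ w
uniquelyEccentric-farthest-unique {d = d} {v} (_ , unique) {u} {w} ε≤u ε≤w =
  unique u w (≤-antisym (d≤ecc d v u) ε≤u) (≤-antisym (d≤ecc d v w) ε≤w)

AtEnd : ∀ {n} → Fin n → Set
AtEnd {n} p = toℕ p ≡ 0 ⊎ suc (toℕ p) ≡ n

¬atEnd⇒neighbours : ∀ {n} (p : Fin n) → ¬ AtEnd p →
  ∃₂ λ (i j : Fin n) → toℕ p ≡ suc (toℕ i) × toℕ j ≡ suc (toℕ p)
¬atEnd⇒neighbours {n} p ¬end with toℕ p | toℕ<n p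
... | zero  | _   = contradiction (inj₁ refl) ¬end
... | suc m | p<n = fromℕ< m<n , fromℕ< 2+m<n , cong suc (≡-sym (toℕ-fromℕ< m<n)) , toℕ-fromℕ< 2+m<n
  where
  m<n : m < n
  m<n = ≤-trans (n<1+n m) (<⇒≤ p<n)
  2+m<n : suc (suc m) < n
  2+m<n = ≤∧≢⇒< p<n (¬end ∘ inj₂)

atEnd? : ∀ {n} (p : Fin n) → Dec (AtEnd p)
atEnd? {n} p = (toℕ p ≟ 0) ⊎-dec (suc (toℕ p) ≟ n)

atEnd-pigeonhole : ∀ {n} {p q s : Fin n} → AtEnd p → AtEnd q → AtEnd s →
  p ≡ q ⊎ p ≡ s ⊎ q ≡ s
atEnd-pigeonhole (inj₁ p) (inj₁ q) _ = inj₁ (toℕ-injective (trans p (≡-sym q)))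
atEnd-pigeonhole (inj₂ p) (inj₂ q) _ = inj₁ (toℕ-injective (suc-injective (trans p (≡-sym q))))
atEnd-pigeonhole (inj₁ p) _ (inj₁ s) = inj₂ (inj₁ (toℕ-injective (trans p (≡-sym s))))
atEnd-pigeonhole (inj₂ p) _ (inj₂ s) = inj₂ (inj₁ (toℕ-injective (suc-injective (trans p (≡-sym s)))))
atEnd-pigeonhole _ (inj₁ q) (inj₁ s) = inj₂ (inj₂ (toℕ-injective (trans q (≡-sym s))))
atEnd-pigeonhole _ (inj₂ q) (inj₂ s) = inj₂ (inj₂ (toℕ-injective (suc-injective (trans q (≡-sym s)))))

module _ {n} {G : Graph n} {d : Fin n → Fin n → ℕ} (D : IsDistance G d)
         {k} (φ : Fin n ⤖ Fin n) (dispersed : Dispersed d k φ) where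

  open Bijection φ using (to; injective)

  uniquelyEccentric-atEnd : ∀ {v} → ecc d v ≤ k → UniquelyEccentric d v → ∀ p → to p ≡ v → AtEnd p
  uniquelyEccentric-atEnd ε≤k ue p refl = decidable-stable (atEnd? p) interior-impossible
    where
    interior-impossible : ¬ ¬ AtEnd p
    interior-impossible ¬end with ¬atEnd⇒neighbours p ¬end
    ... | i , j , p≡1+i , j≡1+p = <⇒≢ (m<n+m (toℕ i) {2} (s≤s z≤n)) i≡2+i
      where
      i-far : ecc d (to p) ≤ d (to p) (to i)
      i-far = ≤-trans ε≤k (subst (k ≤_) (distance-sym D (to i) (to p)) (dispersed i p p≡1+i))
      j-far : ecc d (to p) ≤ d (to p) (to j)
      j-far = ≤-trans ε≤k (dispersed p j j≡1+p)
      i≡2+i : toℕ i ≡ suc (suc (toℕ i))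
      i≡2+i = trans (cong toℕ (injective (uniquelyEccentric-farthest-unique {d = d} ue i-far j-far)))
                    (trans j≡1+p (cong suc p≡1+i))

lemma2p4 : ∀ {n : ℕ} (G : Graph n) (d : Fin n → Fin n → ℕ) (r : ℕ) →
    Connected G → IsDistance G d → IsRadius d r →
    (a b c : Fin n) → a ≢ b → a ≢ c → b ≢ c →
    Central d r a → Central d r b → Central d r c →
    UniquelyEccentric d a → UniquelyEccentric d b → UniquelyEccentric d c →
    DL≤ d (r ∸ 1)
lemma2p4 {n} G d r _ D _ a b c a≢b a≢c b≢c ca cb cc ua ub uc k φ dispersed = <⇒≤pred (≰⇒> r≰k)
  where
  open Bijection φ using (to; strictlySurjective)

  position : Fin n → Fin n
  position v = proj₁ (strictlySurjective v)

  position-injective : ∀ {v w} → position v ≡ position w → v ≡ w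
  position-injective {v} {w} e =
    trans (≡-sym (proj₂ (strictlySurjective v))) (trans (cong to e) (proj₂ (strictlySurjective w)))

  r≰k : ¬ r ≤ k
  r≰k r≤k = [ a≢b , [ a≢c , b≢c ]′ ]′
    (Sum.map position-injective (Sum.map position-injective position-injective)
      (atEnd-pigeonhole (atEnd ca ua) (atEnd cb ub) (atEnd cc uc)))
    where
    atEnd : ∀ {v} → Central d r v → UniquelyEccentric d v → AtEnd (position v)
    atEnd {v} cv uv = uniquelyEccentric-atEnd D φ dispersed (subst (_≤ k) (≡-sym cv) r≤k) uv
                        (position v) (proj₂ (strictlySurjective v))
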